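{- Let $G$ be a non-trivial finite group and $m>1$. The maximal number of vertices in a clique of $\mathscr{G}_m(G)$ equals $\max\{m+1,|G|\}$ if $(m,|G|)\neq(2,2)$, and equals $4$ if $(m,|G|)=(2,2)$.
   Context: For a finite group $G$ with identity $e$, $G^\times=G\setminus\{e\}$. For $x\in G^\times$ and $1\leqslant k<l\leqslant m+1$, $\mathbf{x}_{[k,l)}\in G^m$ has $j$-th coordinate $x$ for $k\leqslant j<l$ and $e$ otherwise; $\mathcal{S}$ is the set of all such $\mathbf{x}_{[k,l)}$, and $\mathscr{G}_m(G)=Cay(G^m,\mathcal{S})$ is the graph on $G^m$ with $\mathbf{g}\sim\mathbf{h}$ iff $\mathbf{h}\mathbf{g}^{ -1}\in\mathcal{S}$. -}

module Defs where

open import Level using (_⊔_)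
open import Algebra.Bundles using (Group)
open import Data.Nat using (ℕ; _≤_; _<_)
open import Data.Fin using (Fin; toℕ)
open import Data.Product using (Σ; _×_)
open import Relation.Nullary using (¬_)
open import Relation.Binary.PropositionalEquality using (_≡_; _≢_)
import Relation.Binary.PropositionalEquality as ≡
open import Function.Bundles using (Bijection)

module _ {c ℓ} (G : Group c ℓ) where
  open Group G

  HasOrder : ℕ → Set (c ⊔ ℓ)
  HasOrder n = Bijection (≡.setoid (Fin n)) setoid

  Vertex : ℕ → Set c
  Vertex m = Fin m → Carrier

  _·inv_ : ∀ {m} → Vertex m → Vertex m → Vertex m
  (h ·inv g) j = h j ∙ (g j) ⁻¹

  -- v ∈ 𝒮 : v = x_[k,l) for some x ≠ e and 0 ≤ k < l ≤ m (0-based version of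
  -- 1 ≤ k < l ≤ m+1): coordinate j is x if k ≤ j < l and e otherwise.
  InS : ∀ {m} → Vertex m → Set (c ⊔ ℓ)
  InS {m} v =
    Σ Carrier λ x → ¬ (x ≈ ε) × Σ ℕ λ k → Σ ℕ λ l → k < l × l ≤ m ×
      ((j : Fin m) → (k ≤ toℕ j × toℕ j < l → v j ≈ x)
                   × (¬ (k ≤ toℕ j × toℕ j < l) → v j ≈ ε))

  Adj : ∀ {m} → Vertex m → Vertex m → Set (c ⊔ ℓ)
  Adj g h = InS (h ·inv g)

  -- a clique with t vertices: t pairwise adjacent vertices
  -- (adjacent vertices are automatically distinct since e ∉ 𝒮)
  Clique : (m t : ℕ) → Set (c ⊔ ℓ)
  Clique m t = Σ (Fin t → Vertex m) λ f → (i j : Fin t) → i ≢ j → Adj (f i) (f j)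

  IsCliqueNumber : (m N : ℕ) → Set (c ⊔ ℓ)
  IsCliqueNumber m N = Clique m N × ((t : ℕ) → Clique m t → t ≤ N)

-- Record a vertex u ∈ Gᵐ by its difference sequence Δu_p = u_{p-1}⁻¹ u_p, 0 ≤ p ≤ m, where u is
-- extended by e on both sides. The generator x_[k,l) has Δ equal to x at k, x⁻¹ at l and e elsewhere,
-- and Δ of adjacent vertices differs in exactly two positions. Translate a clique so that one vertex
-- is e; every other vertex s is then a jump of height x_s between positions k_s < l_s. Pairwise
-- adjacency forces: two vertices with the same end pair differ at both ends, two with different
-- pairs agree where the pairs meet, and any two pairs meet. Hence either all pairs coincide (the
-- heights and e are distinct: at most |G| vertices), or the pairs are distinct with a common point
-- (at most m + 1 vertices), or they are the sides {u,v}, {u,w}, {v,w} of a triangle u < v < w (at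
-- most 4 vertices, and comparing heights at u, v, w yields an involution, impossible if |G| = 3).
-- Constant vertices, the staircase x_[0,i) and, for m = |G| = 2, the staircase plus (e, a) attain
-- the bounds.

module Submission where

open import Defs
open import Level using (Level)
open import Algebra.Bundles using (Group)
open import Data.Nat using (ℕ; _≤_; _<_; _+_; _⊔_)
open import Data.Product using (_×_)
open import Relation.Nullary using (¬_)
open import Relation.Binary.PropositionalEquality using (_≡_)

import Level as L
open import Data.Nat using (zero; suc; z≤n; s≤s; _≟_; _<?_; _≤?_)
import Data.Nat.Properties as ℕ
open import Data.Fin using (Fin; zero; suc; toℕ; fromℕ<)
import Data.Fin.Properties as Fin
open import Data.Vec.Functional using ([]; _∷_)
open import Data.Product using (∃-syntax; _,_; proj₁; proj₂)
open import Data.Product.Properties using (≡-dec)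
open import Data.Sum using (_⊎_; inj₁; inj₂)
open import Data.Empty using (⊥-elim)
open import Function using (_∘_)
open import Function.Bundles using (Bijection; Surjection)
open import Function.Definitions using (Injective)
open import Relation.Binary.Bundles using (Setoid)
open import Relation.Binary.Definitions using (Decidable; tri<; tri≈; tri>)
open import Relation.Nullary using (Dec; yes; no)
open import Relation.Nullary.Decidable using (_×-dec_; _⊎-dec_; ¬?; decidable-stable)
open import Relation.Binary.PropositionalEquality using (_≢_; refl; cong; subst)
import Relation.Binary.PropositionalEquality as ≡

module _ {a ℓ} (S : Setoid a ℓ) where
  open Setoid S

  injective∧covered⇒≤ : ∀ {t k} {f : Fin t → Carrier} (cover : Fin k → Carrier) →
                        Injective _≡_ _≈_ f → (∀ i → ∃[ j ] f i ≈ cover j) → t ≤ k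
  injective∧covered⇒≤ cover f-injective covered = Fin.injective⇒≤ index-injective
    where
    index-injective : Injective _≡_ _≡_ (proj₁ ∘ covered)
    index-injective {i} {j} same-index = f-injective
      (trans (proj₂ (covered i)) (trans (reflexive (cong cover same-index)) (sym (proj₂ (covered j)))))

infix 4 _∈ᵖ_ _∈ᵖ?_ _≟ᵖ_

_∈ᵖ_ : ℕ → ℕ × ℕ → Set
p ∈ᵖ (a , b) = p ≡ a ⊎ p ≡ b

_∈ᵖ?_ : Decidable _∈ᵖ_
p ∈ᵖ? (a , b) = (p ≟ a) ⊎-dec (p ≟ b)

_≟ᵖ_ : Decidable {A = ℕ × ℕ} _≡_
_≟ᵖ_ = ≡-dec _≟_ _≟_

∈ᵖ-pigeonhole : ∀ {a b u v w} → u ∈ᵖ (a , b) → v ∈ᵖ (a , b) → w ∈ᵖ (a , b) → u ≢ v → w ∈ᵖ (u , v)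
∈ᵖ-pigeonhole (inj₁ refl) (inj₁ refl) _           u≢v = ⊥-elim (u≢v refl)
∈ᵖ-pigeonhole (inj₁ refl) (inj₂ refl) w∈          _   = w∈
∈ᵖ-pigeonhole (inj₂ refl) (inj₁ refl) (inj₁ refl) _   = inj₂ refl
∈ᵖ-pigeonhole (inj₂ refl) (inj₁ refl) (inj₂ refl) _   = inj₁ refl
∈ᵖ-pigeonhole (inj₂ refl) (inj₂ refl) _           u≢v = ⊥-elim (u≢v refl)

∈ᵖ-resolve : ∀ {u v w P} → w ∈ᵖ (u , v) → w ∈ᵖ P → ¬ u ∈ᵖ P → v ∈ᵖ P
∈ᵖ-resolve (inj₁ refl) w∈P u∉P = ⊥-elim (u∉P w∈P)
∈ᵖ-resolve (inj₂ refl) w∈P _   = w∈P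

sorted-pair : ∀ {a b u v} → a < b → u ∈ᵖ (a , b) → v ∈ᵖ (a , b) → u < v → (a , b) ≡ (u , v)
sorted-pair _   (inj₁ refl) (inj₁ refl) u<u = ⊥-elim (ℕ.<-irrefl refl u<u)
sorted-pair _   (inj₁ refl) (inj₂ refl) _   = refl
sorted-pair a<b (inj₂ refl) (inj₁ refl) b<a = ⊥-elim (ℕ.<-asym a<b b<a)
sorted-pair _   (inj₂ refl) (inj₂ refl) u<u = ⊥-elim (ℕ.<-irrefl refl u<u)

pair-determined : ∀ {a b a′ b′ u v} → a < b → a′ < b′ → u ≢ v →
                  u ∈ᵖ (a , b) → v ∈ᵖ (a , b) → u ∈ᵖ (a′ , b′) → v ∈ᵖ (a′ , b′) → (a , b) ≡ (a′ , b′)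
pair-determined {u = u} {v} a<b a′<b′ u≢v u∈ v∈ u∈′ v∈′ with ℕ.<-cmp u v
... | tri< u<v _ _ = ≡.trans (sorted-pair a<b u∈ v∈ u<v) (≡.sym (sorted-pair a′<b′ u∈′ v∈′ u<v))
... | tri≈ _ u≡v _ = ⊥-elim (u≢v u≡v)
... | tri> _ _ v<u = ≡.trans (sorted-pair a<b v∈ u∈ v<u) (≡.sym (sorted-pair a′<b′ v∈′ u∈′ v<u))

InInterval : ℕ → ℕ → ℕ → Set
InInterval k l j = k ≤ j × j < l

InInterval? : ∀ k l j → Dec (InInterval k l j)
InInterval? k l j = (k ≤? j) ×-dec (j <? l)

module _ {c ℓ} (G : Group c ℓ) where
  open Group G renaming (refl to ≈-refl)
  open import Algebra.Properties.Group G
  open import Relation.Binary.Reasoning.Setoid setoid using (begin_; step-≈-⟩; step-≈-⟨; step-≡-⟩; _∎)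

  ⁻¹-≉ε : ∀ {x} → ¬ x ≈ ε → ¬ x ⁻¹ ≈ ε
  ⁻¹-≉ε x≉ε x⁻¹≈ε = x≉ε (⁻¹-injective (trans x⁻¹≈ε (sym ε⁻¹≈ε)))

  HasInvolution : Set (c L.⊔ ℓ)
  HasInvolution = ∃[ y ] ¬ y ≈ ε × y ≈ y ⁻¹

  ε,y,w,yw-injective : ∀ {y w} → ¬ y ≈ ε → y ≈ y ⁻¹ → ¬ w ≈ ε → ¬ w ≈ y →
                       Injective _≡_ _≈_ (ε ∷ y ∷ w ∷ y ∙ w ∷ [])
  ε,y,w,yw-injective {y} {w} y≉ε y≈y⁻¹ w≉ε w≉y = injective _ _
    where
    ε≉yw : ¬ ε ≈ y ∙ w
    ε≉yw ε≈yw = w≉y (trans (inverseʳ-unique y w (sym ε≈yw)) (sym y≈y⁻¹))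
    y≉yw : ¬ y ≈ y ∙ w
    y≉yw y≈yw = w≉ε (sym (∙-cancelˡ y ε w (trans (identityʳ y) y≈yw)))
    w≉yw : ¬ w ≈ y ∙ w
    w≉yw w≈yw = y≉ε (sym (∙-cancelʳ w ε y (trans (identityˡ w) w≈yw)))
    injective : ∀ i j → (ε ∷ y ∷ w ∷ y ∙ w ∷ []) i ≈ (ε ∷ y ∷ w ∷ y ∙ w ∷ []) j → i ≡ j
    injective zero                   zero                   _ = refl
    injective zero                   (suc zero)             e = ⊥-elim (y≉ε (sym e))
    injective zero                   (suc (suc zero))       e = ⊥-elim (w≉ε (sym e))
    injective zero                   (suc (suc (suc zero))) e = ⊥-elim (ε≉yw e)
    injective (suc zero)             zero                   e = ⊥-elim (y≉ε e)
    injective (suc zero)             (suc zero)             _ = refl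
    injective (suc zero)             (suc (suc zero))       e = ⊥-elim (w≉y (sym e))
    injective (suc zero)             (suc (suc (suc zero))) e = ⊥-elim (y≉yw e)
    injective (suc (suc zero))       zero                   e = ⊥-elim (w≉ε e)
    injective (suc (suc zero))       (suc zero)             e = ⊥-elim (w≉y e)
    injective (suc (suc zero))       (suc (suc zero))       _ = refl
    injective (suc (suc zero))       (suc (suc (suc zero))) e = ⊥-elim (w≉yw e)
    injective (suc (suc (suc zero))) zero                   e = ⊥-elim (ε≉yw (sym e))
    injective (suc (suc (suc zero))) (suc zero)             e = ⊥-elim (y≉yw (sym e))
    injective (suc (suc (suc zero))) (suc (suc zero))       e = ⊥-elim (w≉yw (sym e))
    injective (suc (suc (suc zero))) (suc (suc (suc zero))) _ = refl

  module Order {n} (order : HasOrder G n) where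
    open Bijection order using (to; injective; to⁻; surjection)

    to∘to⁻ : ∀ g → to (to⁻ g) ≈ g
    to∘to⁻ = Surjection.to∘to⁻ surjection

    injective⇒≤order : ∀ {t} {f : Fin t → Carrier} → Injective _≡_ _≈_ f → t ≤ n
    injective⇒≤order {f = f} f-injective =
      injective∧covered⇒≤ setoid to f-injective (λ i → to⁻ (f i) , sym (to∘to⁻ (f i)))

    infix 4 _≈?_
    _≈?_ : Decidable _≈_
    g ≈? h with to⁻ g Fin.≟ to⁻ h
    ... | yes same = yes (begin
      g            ≈⟨ to∘to⁻ g ⟨
      to (to⁻ g)   ≡⟨ cong to same ⟩
      to (to⁻ h)   ≈⟨ to∘to⁻ h ⟩
      h            ∎)
    ... | no differ = no λ g≈h → differ (injective (trans (to∘to⁻ g) (trans g≈h (sym (to∘to⁻ h)))))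

    nontrivial : 1 < n → ∃[ x ] ¬ x ≈ ε
    nontrivial (s≤s (s≤s _)) =
      to zero ∙ to (suc zero) ⁻¹ , λ quotient≈ε → 0≢1 (injective (x∙y⁻¹≈ε⇒x≈y _ _ quotient≈ε))
      where
      0≢1 : zero ≢ suc zero
      0≢1 ()

    order<3⇒self-inverse : n < 3 → ∀ a → a ≈ a ⁻¹
    order<3⇒self-inverse n<3 a with a ≈? ε | a ∙ a ≈? ε
    ... | yes a≈ε | _        = trans a≈ε (trans (sym ε⁻¹≈ε) (⁻¹-cong (sym a≈ε)))
    ... | no _    | yes aa≈ε = inverseˡ-unique a a aa≈ε
    ... | no a≉ε  | no aa≉ε  = ⊥-elim (ℕ.<⇒≱ n<3 (injective⇒≤order (distinct _ _)))
      where
      distinct : ∀ i j → (ε ∷ a ∷ a ∙ a ∷ []) i ≈ (ε ∷ a ∷ a ∙ a ∷ []) j → i ≡ j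
      distinct zero             zero             _ = refl
      distinct zero             (suc zero)       e = ⊥-elim (a≉ε (sym e))
      distinct zero             (suc (suc zero)) e = ⊥-elim (aa≉ε (sym e))
      distinct (suc zero)       zero             e = ⊥-elim (a≉ε e)
      distinct (suc zero)       (suc zero)       _ = refl
      distinct (suc zero)       (suc (suc zero)) e =
        ⊥-elim (a≉ε (sym (∙-cancelˡ a ε a (trans (identityʳ a) e))))
      distinct (suc (suc zero)) zero             e = ⊥-elim (aa≉ε e)
      distinct (suc (suc zero)) (suc zero)       e =
        ⊥-elim (a≉ε (sym (∙-cancelˡ a ε a (trans (identityʳ a) (sym e)))))
      distinct (suc (suc zero)) (suc (suc zero)) _ = refl

    involution∧3≤order⇒4≤order : HasInvolution → 3 ≤ n → 4 ≤ n
    involution∧3≤order⇒4≤order (y , y≉ε , y≈y⁻¹) 3≤n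
      with Fin.any? (λ i → ¬? ((to i ≈? ε) ⊎-dec (to i ≈? y)))
    ... | yes (i , fresh) =
      injective⇒≤order (ε,y,w,yw-injective y≉ε y≈y⁻¹ (fresh ∘ inj₁) (fresh ∘ inj₂))
    ... | no none = ⊥-elim (ℕ.<⇒≱ 3≤n (injective∧covered⇒≤ setoid (ε ∷ y ∷ []) injective cover))
      where
      cover : ∀ i → ∃[ j ] to i ≈ (ε ∷ y ∷ []) j
      cover i with decidable-stable ((to i ≈? ε) ⊎-dec (to i ≈? y)) (λ fresh → none (i , fresh))
      ... | inj₁ ≈ε = zero , ≈ε
      ... | inj₂ ≈y = suc zero , ≈y

  _‼_ : ∀ {m} → Vertex G m → ℕ → Carrier
  _‼_ {zero}  u _       = ε
  _‼_ {suc m} u zero    = u zero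
  _‼_ {suc m} u (suc j) = (λ i → u (suc i)) ‼ j

  ‼-elim : ∀ {m r} (P : ℕ → Carrier → Set r) (u : Vertex G m) →
           (∀ i → P (toℕ i) (u i)) → (∀ {j} → m ≤ j → P j ε) → ∀ j → P j (u ‼ j)
  ‼-elim {zero}  P u _      beyond j       = beyond z≤n
  ‼-elim {suc m} P u within _      zero    = within zero
  ‼-elim {suc m} P u within beyond (suc j) =
    ‼-elim (P ∘ suc) (λ i → u (suc i)) (within ∘ suc) (beyond ∘ s≤s) j

  ‼-∙ : ∀ {m} {u v w : Vertex G m} → (∀ i → w i ≈ u i ∙ v i) → ∀ j → w ‼ j ≈ u ‼ j ∙ v ‼ j
  ‼-∙ {zero}  _       _       = sym (identityˡ ε)
  ‼-∙ {suc m} product zero    = product zero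
  ‼-∙ {suc m} product (suc j) = ‼-∙ (product ∘ suc) j

  before : ∀ {m} → Vertex G m → ℕ → Carrier
  before u zero    = ε
  before u (suc j) = u ‼ j

  Δ : ∀ {m} → Vertex G m → ℕ → Carrier
  Δ u p = before u p ⁻¹ ∙ u ‼ p

  IntervalValue : Carrier → ℕ → ℕ → ℕ → Carrier → Set ℓ
  IntervalValue x k l j g = (InInterval k l j → g ≈ x) × (¬ InInterval k l j → g ≈ ε)

  inside : ∀ {x k l j g} → InInterval k l j → g ≈ x → IntervalValue x k l j g
  inside in-kl g≈x = (λ _ → g≈x) , λ out → ⊥-elim (out in-kl)

  outside : ∀ {x k l j g} → ¬ InInterval k l j → g ≈ ε → IntervalValue x k l j g
  outside out g≈ε = (λ in-kl → ⊥-elim (out in-kl)) , λ _ → g≈ε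

  IsInterval : ∀ {m} → Vertex G m → Carrier → ℕ → ℕ → Set ℓ
  IsInterval v x k l = ∀ j → IntervalValue x k l j (v ‼ j)

  record IsJump (D : ℕ → Carrier) (x : Carrier) (k l : ℕ) : Set ℓ where
    field
      at-start  : D k ≈ x
      at-end    : D l ≈ x ⁻¹
      elsewhere : ∀ {p} → ¬ p ∈ᵖ (k , l) → D p ≈ ε

  Δ-interval : ∀ {m} {v : Vertex G m} {x k l} → k < l → IsInterval v x k l → IsJump (Δ v) x k l
  Δ-interval {v = v} {x} {k} {l} k<l interval = record
    { at-start  = begin
        before v k ⁻¹ ∙ v ‼ k ≈⟨ ∙-cong (⁻¹-cong (before-start k ℕ.≤-refl)) (in-value (ℕ.≤-refl , k<l)) ⟩
        ε ⁻¹ ∙ x               ≈⟨ ∙-congʳ ε⁻¹≈ε ⟩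
        ε ∙ x                  ≈⟨ identityˡ x ⟩
        x                      ∎
    ; at-end    = at-end l k<l refl
    ; elsewhere = elsewhere _
    }
    where
    in-value  = λ {j} → proj₁ (interval j)
    out-value = λ {j} → proj₂ (interval j)

    before-start : ∀ p → p ≤ k → before v p ≈ ε
    before-start zero    _   = ≈-refl
    before-start (suc j) j<k = out-value λ (k≤j , _) → ℕ.<⇒≱ j<k k≤j

    at-end : ∀ p → k < p → p ≡ l → Δ v p ≈ x ⁻¹
    at-end (suc j) (s≤s k≤j) refl = begin
      v ‼ j ⁻¹ ∙ v ‼ suc j ≈⟨ ∙-cong (⁻¹-cong (in-value (k≤j , ℕ.≤-refl)))
                                     (out-value λ (_ , l<l) → ℕ.<-irrefl refl l<l) ⟩
      x ⁻¹ ∙ ε             ≈⟨ identityʳ (x ⁻¹) ⟩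
      x ⁻¹                 ∎

    elsewhere : ∀ p → ¬ p ∈ᵖ (k , l) → Δ v p ≈ ε
    elsewhere zero    p∉ = begin
      ε ⁻¹ ∙ v ‼ 0 ≈⟨ ∙-cong ε⁻¹≈ε (out-value λ (k≤0 , _) → p∉ (inj₁ (≡.sym (ℕ.n≤0⇒n≡0 k≤0)))) ⟩
      ε ∙ ε        ≈⟨ identityˡ ε ⟩
      ε            ∎
    elsewhere (suc j) p∉ with InInterval? k l j
    ... | yes (k≤j , j<l) = begin
      v ‼ j ⁻¹ ∙ v ‼ suc j ≈⟨ ∙-cong (⁻¹-cong (in-value (k≤j , j<l))) (in-value (ℕ.m≤n⇒m≤1+n k≤j , 1+j<l)) ⟩
      x ⁻¹ ∙ x             ≈⟨ inverseˡ x ⟩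
      ε                    ∎
      where 1+j<l = ℕ.≤∧≢⇒< j<l (p∉ ∘ inj₂)
    ... | no j∉ = begin
      v ‼ j ⁻¹ ∙ v ‼ suc j ≈⟨ ∙-cong (⁻¹-cong (out-value j∉)) (out-value 1+j∉) ⟩
      ε ⁻¹ ∙ ε             ≈⟨ inverseˡ ε ⟩
      ε                    ∎
      where
      1+j∉ : ¬ InInterval k l (suc j)
      1+j∉ (k≤1+j , 1+j<l) = j∉ (ℕ.≤-pred (ℕ.≤∧≢⇒< k≤1+j (p∉ ∘ inj₁ ∘ ≡.sym)) , ℕ.<-trans (ℕ.n<1+n j) 1+j<l)

  record Jump (m : ℕ) (D : ℕ → Carrier) : Set (c L.⊔ ℓ) where
    field
      height    : Carrier
      height≉ε  : ¬ height ≈ ε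
      start end : ℕ
      start<end : start < end
      end≤m     : end ≤ m
      isJump    : IsJump D height start end
    open IsJump isJump public

    ends : ℕ × ℕ
    ends = start , end

    ≉ε-at-ends : ∀ {p} → p ∈ᵖ ends → ¬ D p ≈ ε
    ≉ε-at-ends (inj₁ refl) D≈ε = height≉ε (trans (sym at-start) D≈ε)
    ≉ε-at-ends (inj₂ refl) D≈ε = ⁻¹-≉ε height≉ε (trans (sym at-end) D≈ε)

    ∈ends⇒≤m : ∀ {p} → p ∈ᵖ ends → p ≤ m
    ∈ends⇒≤m (inj₁ refl) = ℕ.≤-trans (ℕ.<⇒≤ start<end) end≤m
    ∈ends⇒≤m (inj₂ refl) = end≤m

  InS⇒Jump : ∀ {m} {v : Vertex G m} → InS G v → Jump m (Δ v)
  InS⇒Jump {m} {v} (x , x≉ε , k , l , k<l , l≤m , body) = record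
    { height = x ; height≉ε = x≉ε ; start = k ; end = l ; start<end = k<l ; end≤m = l≤m
    ; isJump = Δ-interval k<l (‼-elim (IntervalValue x k l) v body beyond)
    }
    where
    beyond : ∀ {j} → m ≤ j → IntervalValue x k l j ε
    beyond m≤j = outside (λ (_ , j<l) → ℕ.<⇒≱ j<l (ℕ.≤-trans l≤m m≤j)) ≈-refl

  InS-resp : ∀ {m} {v w : Vertex G m} → (∀ j → v j ≈ w j) → InS G v → InS G w
  InS-resp v≈w (x , x≉ε , k , l , k<l , l≤m , body) =
    x , x≉ε , k , l , k<l , l≤m ,
    λ j → (trans (sym (v≈w j)) ∘ proj₁ (body j)) , (trans (sym (v≈w j)) ∘ proj₂ (body j))

  InS-⁻¹ : ∀ {m} {v : Vertex G m} → InS G v → InS G (λ j → v j ⁻¹)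
  InS-⁻¹ (x , x≉ε , k , l , k<l , l≤m , body) =
    x ⁻¹ , ⁻¹-≉ε x≉ε , k , l , k<l , l≤m ,
    λ j → (⁻¹-cong ∘ proj₁ (body j)) , (λ out → trans (⁻¹-cong (proj₂ (body j) out)) ε⁻¹≈ε)

  Adj-sym : ∀ {m} {g h : Vertex G m} → Adj G g h → Adj G h g
  Adj-sym {g = g} {h} adj = InS-resp flip (InS-⁻¹ adj)
    where
    flip : ∀ j → (h j ∙ g j ⁻¹) ⁻¹ ≈ g j ∙ h j ⁻¹
    flip j = trans (⁻¹-anti-homo-∙ (h j) (g j ⁻¹)) (∙-congʳ (⁻¹-involutive (g j)))

  Adj-·inv : ∀ {m} {g h : Vertex G m} (u : Vertex G m) → Adj G g h → Adj G (_·inv_ G g u) (_·inv_ G h u)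
  Adj-·inv {g = g} {h} u = InS-resp λ j → sym (cancel (g j) (h j) (u j))
    where
    cancel : ∀ x y w → (y ∙ w ⁻¹) ∙ (x ∙ w ⁻¹) ⁻¹ ≈ y ∙ x ⁻¹
    cancel x y w = begin
      (y ∙ w ⁻¹) ∙ (x ∙ w ⁻¹) ⁻¹       ≈⟨ ∙-congˡ (⁻¹-anti-homo-∙ x (w ⁻¹)) ⟩
      (y ∙ w ⁻¹) ∙ (w ⁻¹ ⁻¹ ∙ x ⁻¹)   ≈⟨ assoc y (w ⁻¹) _ ⟩
      y ∙ (w ⁻¹ ∙ (w ⁻¹ ⁻¹ ∙ x ⁻¹))   ≈⟨ ∙-congˡ (assoc (w ⁻¹) (w ⁻¹ ⁻¹) (x ⁻¹)) ⟨
      y ∙ ((w ⁻¹ ∙ w ⁻¹ ⁻¹) ∙ x ⁻¹)   ≈⟨ ∙-congˡ (∙-congʳ (inverseʳ (w ⁻¹))) ⟩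
      y ∙ (ε ∙ x ⁻¹)                   ≈⟨ ∙-congˡ (identityˡ (x ⁻¹)) ⟩
      y ∙ x ⁻¹                         ∎

  record DifferInTwo (D D′ : ℕ → Carrier) : Set ℓ where
    field
      K L    : ℕ
      K≢L    : K ≢ L
      differ : ∀ {p} → p ∈ᵖ (K , L) → ¬ D p ≈ D′ p
      agree  : ∀ {p} → ¬ p ∈ᵖ (K , L) → D p ≈ D′ p

    differ⇒∈ : ∀ {p} → ¬ D p ≈ D′ p → p ∈ᵖ (K , L)
    differ⇒∈ {p} D≉D′ = decidable-stable (p ∈ᵖ? (K , L)) (D≉D′ ∘ agree)

  Δ-·inv : ∀ {m} (g h : Vertex G m) p → Δ h p ≈ before g p ⁻¹ ∙ (Δ (_·inv_ G h g) p ∙ g ‼ p)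
  Δ-·inv g h p = begin
    before h p ⁻¹ ∙ h ‼ p                                   ≈⟨ ∙-cong (⁻¹-cong (before-∙ p)) (‼-∙ h≈ p) ⟩
    (before W p ∙ before g p) ⁻¹ ∙ (W ‼ p ∙ g ‼ p)          ≈⟨ ∙-congʳ (⁻¹-anti-homo-∙ _ _) ⟩
    (before g p ⁻¹ ∙ before W p ⁻¹) ∙ (W ‼ p ∙ g ‼ p)       ≈⟨ assoc _ _ _ ⟩
    before g p ⁻¹ ∙ (before W p ⁻¹ ∙ (W ‼ p ∙ g ‼ p))       ≈⟨ ∙-congˡ (assoc _ _ _) ⟨
    before g p ⁻¹ ∙ (Δ W p ∙ g ‼ p)                         ∎
    where
    W = _·inv_ G h g
    h≈ : ∀ i → h i ≈ W i ∙ g i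
    h≈ i = sym (trans (assoc _ _ _) (trans (∙-congˡ (inverseˡ (g i))) (identityʳ (h i))))
    before-∙ : ∀ p → before h p ≈ before W p ∙ before g p
    before-∙ zero    = sym (identityˡ ε)
    before-∙ (suc j) = ‼-∙ h≈ j

  Δ-adjacent : ∀ {m} {g h : Vertex G m} → Adj G g h → DifferInTwo (Δ g) (Δ h)
  Δ-adjacent {g = g} {h} adj = record
    { K = start ; L = end ; K≢L = ℕ.<⇒≢ start<end
    ; differ = λ p∈ Δg≈Δh → ≉ε-at-ends p∈ (sym (same-Δ⇒ε Δg≈Δh))
    ; agree  = λ p∉ → sym (trans (Δ-·inv g h _) (∙-congˡ (trans (∙-congʳ (elsewhere p∉)) (identityˡ _))))
    }
    where
    open Jump (InS⇒Jump adj)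
    same-Δ⇒ε : ∀ {p} → Δ g p ≈ Δ h p → ε ≈ Δ (_·inv_ G h g) p
    same-Δ⇒ε {p} Δg≈Δh = ∙-cancelʳ (g ‼ p) ε _
      (trans (identityˡ _) (∙-cancelˡ (before g p ⁻¹) _ _ (trans Δg≈Δh (Δ-·inv g h p))))

  CliqueBound : ℕ → ℕ → ℕ → Set (c L.⊔ ℓ)
  CliqueBound n m t = t ≤ n ⊎ t ≤ suc m ⊎ (t ≤ 4 × HasInvolution)

  -- D s is Δ of the (s+1)-st vertex of a clique translated so that its 0-th vertex is e.
  module JumpFamily {n N m} (order : HasOrder G n) (D : Fin N → ℕ → Carrier) (jump : ∀ s → Jump m (D s))
                    (differInTwo : ∀ {s s′} → s ≢ s′ → DifferInTwo (D s) (D s′)) where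
    open Order order using (injective⇒≤order)
    open Jump using (height; height≉ε; start; end; start<end; ∈ends⇒≤m)
    private
      variable
        s s′ : Fin N
        p k l : ℕ

    ends : Fin N → ℕ × ℕ
    ends s = Jump.ends (jump s)

    at-start-of : ends s ≡ (k , l) → D s k ≈ height (jump s)
    at-start-of {s} refl = Jump.at-start (jump s)

    at-end-of : ends s ≡ (k , l) → D s l ≈ height (jump s) ⁻¹
    at-end-of {s} refl = Jump.at-end (jump s)

    start∈ : ends s ≡ (k , l) → k ∈ᵖ ends s
    start∈ e = subst (_ ∈ᵖ_) (≡.sym e) (inj₁ refl)

    end∈ : ends s ≡ (k , l) → l ∈ᵖ ends s
    end∈ e = subst (_ ∈ᵖ_) (≡.sym e) (inj₂ refl)

    exclusive⇒differ : p ∈ᵖ ends s → ¬ p ∈ᵖ ends s′ → ¬ D s p ≈ D s′ p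
    exclusive⇒differ {s = s} {s′} p∈ p∉ D≈D′ =
      Jump.≉ε-at-ends (jump s) p∈ (trans D≈D′ (Jump.elsewhere (jump s′) p∉))

    ends-meet : s ≢ s′ → ∃[ p ] p ∈ᵖ ends s × p ∈ᵖ ends s′
    ends-meet {s} {s′} s≢s′
      with start (jump s) ∈ᵖ? ends s′ | end (jump s) ∈ᵖ? ends s′ | start (jump s′) ∈ᵖ? ends s
    ... | yes k∈ | _      | _       = _ , inj₁ refl , k∈
    ... | no _   | yes l∈ | _       = _ , inj₂ refl , l∈
    ... | no _   | no _   | yes k′∈ = _ , k′∈ , inj₁ refl
    ... | no k∉  | no l∉  | no k′∉  =
      ⊥-elim (k′∉ (∈ᵖ-pigeonhole (differ⇒∈ (exclusive⇒differ (inj₁ refl) k∉))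
                                 (differ⇒∈ (exclusive⇒differ (inj₂ refl) l∉))
                                 (differ⇒∈ (exclusive⇒differ (inj₁ refl) k′∉ ∘ sym))
                                 (ℕ.<⇒≢ (start<end (jump s)))))
      where open DifferInTwo (differInTwo s≢s′)

    shared-ends⇒differ : s ≢ s′ → ends s ≡ ends s′ → p ∈ᵖ ends s → ¬ D s p ≈ D s′ p
    shared-ends⇒differ {s} {s′} s≢s′ same p∈ =
      differ (∈ᵖ-pigeonhole (in-ends (inj₁ refl)) (in-ends (inj₂ refl)) p∈ K≢L)
      where
      open DifferInTwo (differInTwo s≢s′)
      in-ends : ∀ {q} → q ∈ᵖ (K , L) → q ∈ᵖ ends s
      in-ends {q} q∈ = decidable-stable (q ∈ᵖ? ends s) λ q∉ → differ q∈
        (trans (Jump.elsewhere (jump s) q∉)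
               (sym (Jump.elsewhere (jump s′) (subst (λ P → ¬ q ∈ᵖ P) same q∉))))

    private-end : ends s ≢ ends s′ → ∃[ p ] p ∈ᵖ ends s × ¬ p ∈ᵖ ends s′
    private-end {s} {s′} ends≢ with start (jump s) ∈ᵖ? ends s′ | end (jump s) ∈ᵖ? ends s′
    ... | no k∉  | _      = _ , inj₁ refl , k∉
    ... | yes _  | no l∉  = _ , inj₂ refl , l∉
    ... | yes k∈ | yes l∈ =
      ⊥-elim (ends≢ (≡.sym (sorted-pair (start<end (jump s′)) k∈ l∈ (start<end (jump s)))))

    distinct-ends⇒agree : ends s ≢ ends s′ → p ∈ᵖ ends s → p ∈ᵖ ends s′ → D s p ≈ D s′ p
    distinct-ends⇒agree {s} {s′} {p} ends≢ p∈s p∈s′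
      with private-end ends≢ | private-end (ends≢ ∘ ≡.sym)
    ... | a , a∈s , a∉s′ | b , b∈s′ , b∉s = agree p∉KL
      where
      open DifferInTwo (differInTwo (ends≢ ∘ cong ends))
      p∉KL : ¬ p ∈ᵖ (K , L)
      p∉KL p∈KL with ∈ᵖ-pigeonhole (differ⇒∈ (exclusive⇒differ a∈s a∉s′))
                                   (differ⇒∈ (exclusive⇒differ b∈s′ b∉s ∘ sym)) p∈KL
                                   (λ a≡b → a∉s′ (subst (_∈ᵖ ends s′) (≡.sym a≡b) b∈s′))
      ... | inj₁ p≡a = a∉s′ (subst (_∈ᵖ ends s′) p≡a p∈s′)
      ... | inj₂ p≡b = b∉s (subst (_∈ᵖ ends s) p≡b p∈s)

    shared-ends⇒constant : s ≢ s′ → ends s ≡ ends s′ → ∀ w → ends w ≡ ends s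
    shared-ends⇒constant {s} {s′} s≢s′ same w with ends w ≟ᵖ ends s
    ... | yes w≡s = w≡s
    ... | no w≢s with ends-meet (w≢s ∘ cong ends)
    ...   | p , p∈w , p∈s = ⊥-elim (shared-ends⇒differ s≢s′ same p∈s (begin
      D s p  ≈⟨ distinct-ends⇒agree w≢s p∈w p∈s ⟨
      D w p  ≈⟨ distinct-ends⇒agree (w≢s ∘ λ w≡s′ → ≡.trans w≡s′ (≡.sym same))
                                    p∈w (subst (p ∈ᵖ_) same p∈s) ⟩
      D s′ p ∎))

    constant-ends⇒≤order : (∀ s s′ → ends s ≡ ends s′) → suc N ≤ n
    constant-ends⇒≤order constant = injective⇒≤order (injective _ _)
      where
      injective : ∀ i j → (ε ∷ height ∘ jump) i ≈ (ε ∷ height ∘ jump) j → i ≡ j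
      injective zero    zero     _     = refl
      injective zero    (suc s′) ε≈x′  = ⊥-elim (height≉ε (jump s′) (sym ε≈x′))
      injective (suc s) zero     x≈ε   = ⊥-elim (height≉ε (jump s) x≈ε)
      injective (suc s) (suc s′) x≈x′ with s Fin.≟ s′
      ... | yes s≡s′ = cong suc s≡s′
      ... | no s≢s′  = ⊥-elim (shared-ends⇒differ s≢s′ (constant s s′) (inj₁ refl)
                         (trans (at-start-of refl) (trans x≈x′ (sym (at-start-of (constant s′ s))))))

    EndsInjective : Set
    EndsInjective = ∀ {s s′} → ends s ≡ ends s′ → s ≡ s′

    other-end : p ∈ᵖ ends s → ℕ
    other-end {s = s} (inj₁ _) = end (jump s)
    other-end {s = s} (inj₂ _) = start (jump s)

    other-end-∈ : (p∈ : p ∈ᵖ ends s) → other-end p∈ ∈ᵖ ends s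
    other-end-∈ (inj₁ _) = inj₂ refl
    other-end-∈ (inj₂ _) = inj₁ refl

    other-end-≢ : (p∈ : p ∈ᵖ ends s) → p ≢ other-end p∈
    other-end-≢ {s = s} (inj₁ refl) = ℕ.<⇒≢ (start<end (jump s))
    other-end-≢ {s = s} (inj₂ refl) = ℕ.<⇒≢ (start<end (jump s)) ∘ ≡.sym

    common-end⇒≤ : EndsInjective → (∀ s → p ∈ᵖ ends s) → p ≤ m → suc N ≤ suc m
    common-end⇒≤ {p} ends-injective p∈ p≤m =
      injective∧covered⇒≤ (≡.setoid ℕ) toℕ (injective _ _)
                          λ i → fromℕ< (s≤s (≤m i)) , ≡.sym (Fin.toℕ-fromℕ< _)
      where
      positions : Fin (suc N) → ℕ
      positions = p ∷ λ s → other-end (p∈ s)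
      ≤m : ∀ i → positions i ≤ m
      ≤m zero    = p≤m
      ≤m (suc s) = ∈ends⇒≤m (jump s) (other-end-∈ (p∈ s))
      injective : ∀ i j → positions i ≡ positions j → i ≡ j
      injective zero    zero     _ = refl
      injective zero    (suc s′) e = ⊥-elim (other-end-≢ (p∈ s′) e)
      injective (suc s) zero     e = ⊥-elim (other-end-≢ (p∈ s) (≡.sym e))
      injective (suc s) (suc s′) e = cong suc (ends-injective
        (pair-determined (start<end (jump s)) (start<end (jump s′)) (other-end-≢ (p∈ s))
          (p∈ s) (other-end-∈ (p∈ s)) (p∈ s′) (subst (_∈ᵖ ends s′) (≡.sym e) (other-end-∈ (p∈ s′)))))

    record Triangle : Set where
      field
        α β γ   : Fin N
        u v w   : ℕ
        u<v     : u < v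
        v<w     : v < w
        ends-α  : ends α ≡ (u , v)
        ends-β  : ends β ≡ (u , w)
        ends-γ  : ends γ ≡ (v , w)

    sorted-triangle : ∀ {α β γ u v w} → u < v → v < w →
                      u ∈ᵖ ends α → v ∈ᵖ ends α → u ∈ᵖ ends β → w ∈ᵖ ends β → v ∈ᵖ ends γ → w ∈ᵖ ends γ →
                      Triangle
    sorted-triangle {α} {β} {γ} {u} {v} {w} u<v v<w uα vα uβ wβ vγ wγ = record
      { α = α ; β = β ; γ = γ ; u = u ; v = v ; w = w ; u<v = u<v ; v<w = v<w
      ; ends-α = sorted-pair (start<end (jump α)) uα vα u<v
      ; ends-β = sorted-pair (start<end (jump β)) uβ wβ (ℕ.<-trans u<v v<w)
      ; ends-γ = sorted-pair (start<end (jump γ)) vγ wγ v<w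
      }

    triangle : ∀ {s₀ s₁ s₂ p q r} → p ≢ q → q ≢ r → p ≢ r →
               p ∈ᵖ ends s₀ → q ∈ᵖ ends s₀ → p ∈ᵖ ends s₁ → r ∈ᵖ ends s₁ → q ∈ᵖ ends s₂ → r ∈ᵖ ends s₂ →
               Triangle
    triangle {p = p} {q} {r} p≢q q≢r p≢r p₀ q₀ p₁ r₁ q₂ r₂
      with ℕ.<-cmp p q | ℕ.<-cmp q r | ℕ.<-cmp p r
    ... | tri≈ _ p≡q _ | _            | _            = ⊥-elim (p≢q p≡q)
    ... | _            | tri≈ _ q≡r _ | _            = ⊥-elim (q≢r q≡r)
    ... | _            | _            | tri≈ _ p≡r _ = ⊥-elim (p≢r p≡r)
    ... | tri< p<q _ _ | tri< q<r _ _ | _            = sorted-triangle p<q q<r p₀ q₀ p₁ r₁ q₂ r₂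
    ... | tri< _ _ _   | tri> _ _ r<q | tri< p<r _ _ = sorted-triangle p<r r<q p₁ r₁ p₀ q₀ r₂ q₂
    ... | tri< p<q _ _ | tri> _ _ _   | tri> _ _ r<p = sorted-triangle r<p p<q r₁ p₁ r₂ q₂ p₀ q₀
    ... | tri> _ _ q<p | tri< _ _ _   | tri< p<r _ _ = sorted-triangle q<p p<r q₀ p₀ q₂ r₂ p₁ r₁
    ... | tri> _ _ _   | tri< q<r _ _ | tri> _ _ r<p = sorted-triangle q<r r<p q₂ r₂ q₀ p₀ r₁ p₁
    ... | tri> _ _ q<p | tri> _ _ r<q | _            = sorted-triangle r<q q<p r₂ q₂ r₁ p₁ q₀ p₀

    module _ (t : Triangle) where
      open Triangle t

      private
        x : Fin N → Carrier
        x s = height (jump s)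

        ends-α≢β : ends α ≢ ends β
        ends-α≢β e = ℕ.<⇒≢ v<w (cong proj₂ (≡.trans (≡.sym ends-α) (≡.trans e ends-β)))

        ends-α≢γ : ends α ≢ ends γ
        ends-α≢γ e = ℕ.<⇒≢ u<v (cong proj₁ (≡.trans (≡.sym ends-α) (≡.trans e ends-γ)))

        ends-β≢γ : ends β ≢ ends γ
        ends-β≢γ e = ℕ.<⇒≢ u<v (cong proj₁ (≡.trans (≡.sym ends-β) (≡.trans e ends-γ)))

      triangle⇒involution : HasInvolution
      triangle⇒involution = x α , height≉ε (jump α) , (begin
        x α      ≈⟨ at-start-of ends-α ⟨
        D α u    ≈⟨ distinct-ends⇒agree ends-α≢β (start∈ ends-α) (start∈ ends-β) ⟩
        D β u    ≈⟨ at-start-of ends-β ⟩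
        x β      ≈⟨ ⁻¹-injective (begin
          x β ⁻¹   ≈⟨ at-end-of ends-β ⟨
          D β w    ≈⟨ distinct-ends⇒agree ends-β≢γ (end∈ ends-β) (end∈ ends-γ) ⟩
          D γ w    ≈⟨ at-end-of ends-γ ⟩
          x γ ⁻¹   ∎) ⟩
        x γ      ≈⟨ at-start-of ends-γ ⟨
        D γ v    ≈⟨ distinct-ends⇒agree ends-α≢γ (end∈ ends-α) (start∈ ends-γ) ⟨
        D α v    ≈⟨ at-end-of ends-α ⟩
        x α ⁻¹   ∎)

      corners : Fin 3 → ℕ × ℕ
      corners = (u , v) ∷ (u , w) ∷ (v , w) ∷ []

      triangle-cover : ∀ s → ∃[ j ] ends s ≡ corners j
      triangle-cover s with u ∈ᵖ? ends s
      ... | yes u∈s = through-u u∈s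
        where
        through-u : u ∈ᵖ ends s → ∃[ j ] ends s ≡ corners j
        through-u u∈s with s Fin.≟ γ
        ... | yes refl = suc (suc zero) , ends-γ
        ... | no s≢γ with ends-meet s≢γ
        ...   | q , q∈s , q∈γ with subst (q ∈ᵖ_) ends-γ q∈γ
        ...     | inj₁ refl = zero , sorted-pair (start<end (jump s)) u∈s q∈s u<v
        ...     | inj₂ refl = suc zero , sorted-pair (start<end (jump s)) u∈s q∈s (ℕ.<-trans u<v v<w)
      ... | no u∉s with s Fin.≟ α
      ...   | yes refl = zero , ends-α
      ...   | no s≢α with s Fin.≟ β
      ...     | yes refl = suc zero , ends-β
      ...     | no s≢β with ends-meet s≢α | ends-meet s≢β
      ...       | _ , q∈s , q∈α | _ , r∈s , r∈β = suc (suc zero) ,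
        sorted-pair (start<end (jump s)) (∈ᵖ-resolve (subst (_ ∈ᵖ_) ends-α q∈α) q∈s u∉s)
                                         (∈ᵖ-resolve (subst (_ ∈ᵖ_) ends-β r∈β) r∈s u∉s) v<w

      triangle⇒≤4 : EndsInjective → suc N ≤ 4
      triangle⇒≤4 ends-injective =
        s≤s (injective∧covered⇒≤ (≡.setoid (ℕ × ℕ)) corners ends-injective triangle-cover)

    distinct-ends⇒injective : ∀ {s₀ s₁} → ends s₀ ≢ ends s₁ → EndsInjective
    distinct-ends⇒injective {s₀} {s₁} ends≢ {s} {s′} same with s Fin.≟ s′
    ... | yes s≡s′ = s≡s′
    ... | no s≢s′  = ⊥-elim (ends≢ (≡.trans (constant s₀) (≡.sym (constant s₁))))
      where constant = shared-ends⇒constant s≢s′ same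

    triangle-avoiding : ∀ {s₀ s₁ s₂ p} → ends s₀ ≢ ends s₁ →
                        p ∈ᵖ ends s₀ → p ∈ᵖ ends s₁ → ¬ p ∈ᵖ ends s₂ → Triangle
    triangle-avoiding {s₀} {s₁} {s₂} {p} ends≢ p₀ p₁ p∉₂
      with ends-meet {s₀} {s₂} (λ { refl → p∉₂ p₀ }) | ends-meet {s₁} {s₂} (λ { refl → p∉₂ p₁ })
    ... | q , q₀ , q₂ | r , r₁ , r₂ = triangle p≢q q≢r p≢r p₀ q₀ p₁ r₁ q₂ r₂
      where
      p≢q : p ≢ q
      p≢q p≡q = p∉₂ (subst (_∈ᵖ ends s₂) (≡.sym p≡q) q₂)
      p≢r : p ≢ r
      p≢r p≡r = p∉₂ (subst (_∈ᵖ ends s₂) (≡.sym p≡r) r₂)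
      q≢r : q ≢ r
      q≢r q≡r = ends≢ (pair-determined (start<end (jump s₀)) (start<end (jump s₁)) p≢q
                                      p₀ q₀ p₁ (subst (_∈ᵖ ends s₁) (≡.sym q≡r) r₁))

    distinct-ends⇒bound : ∀ {s₀ s₁} → ends s₀ ≢ ends s₁ → CliqueBound n m (suc N)
    distinct-ends⇒bound {s₀} {s₁} ends≢ with ends-meet (ends≢ ∘ cong ends)
    ... | p , p₀ , p₁ with Fin.any? (λ s → ¬? (p ∈ᵖ? ends s))
    ...   | yes (s₂ , p∉₂) = inj₂ (inj₂ (triangle⇒≤4 t ends-injective , triangle⇒involution t))
      where
      t = triangle-avoiding ends≢ p₀ p₁ p∉₂
      ends-injective = distinct-ends⇒injective ends≢
    ...   | no none = inj₂ (inj₁ (common-end⇒≤ (distinct-ends⇒injective ends≢)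
                                   (λ s → decidable-stable (p ∈ᵖ? ends s) (λ p∉ → none (s , p∉)))
                                   (∈ends⇒≤m (jump s₀) p₀)))

    bound : Fin N → CliqueBound n m (suc N)
    bound s₀ with Fin.all? (λ s → ends s ≟ᵖ ends s₀)
    ... | yes constant = inj₁ (constant-ends⇒≤order λ s s′ → ≡.trans (constant s) (≡.sym (constant s′)))
    ... | no not-constant with Fin.¬∀⟶∃¬ N _ (λ s → ends s ≟ᵖ ends s₀) not-constant
    ...   | _ , ends≢ = distinct-ends⇒bound (ends≢ ∘ ≡.sym)

  clique-bound : ∀ {n m t} → HasOrder G n → Clique G m t → CliqueBound n m t
  clique-bound {t = zero}        _     _         = inj₁ z≤n
  clique-bound {t = suc zero}    _     _         = inj₂ (inj₁ (s≤s z≤n))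
  clique-bound {t = suc (suc N)} order (f , adj) =
    JumpFamily.bound order (Δ ∘ translate) jump differInTwo zero
    where
    translate : Fin (suc N) → Vertex G _
    translate s = _·inv_ G (f (suc s)) (f zero)
    jump : ∀ s → Jump _ (Δ (translate s))
    jump s = InS⇒Jump (adj zero (suc s) λ ())
    differInTwo : ∀ {s s′} → s ≢ s′ → DifferInTwo (Δ (translate s)) (Δ (translate s′))
    differInTwo {s} {s′} s≢s′ =
      Δ-adjacent (Adj-·inv (f zero) (adj (suc s) (suc s′) (s≢s′ ∘ Fin.suc-injective)))

  ordered-clique : ∀ {m t} (f : Fin t → Vertex G m) →
                   (∀ {i j} → toℕ i < toℕ j → Adj G (f i) (f j)) → Clique G m t
  ordered-clique f adjacent = f , pairwise
    where
    pairwise : ∀ i j → i ≢ j → Adj G (f i) (f j)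
    pairwise i j i≢j with Fin.<-cmp i j
    ... | tri< i<j _ _ = adjacent i<j
    ... | tri≈ _ i≡j _ = ⊥-elim (i≢j i≡j)
    ... | tri> _ _ j<i = Adj-sym (adjacent j<i)

  extend-clique : ∀ {m t} (K : Clique G m t) (v : Vertex G m) →
                  (∀ i → Adj G (proj₁ K i) v) → Clique G m (suc t)
  extend-clique (f , adj) v v-adj = v ∷ f , pairwise
    where
    pairwise : ∀ i j → i ≢ j → Adj G ((v ∷ f) i) ((v ∷ f) j)
    pairwise zero    zero    0≢0 = ⊥-elim (0≢0 refl)
    pairwise zero    (suc j) _   = Adj-sym (v-adj j)
    pairwise (suc i) zero    _   = v-adj i
    pairwise (suc i) (suc j) i≢j = adj i j (i≢j ∘ cong suc)

  constant-clique : ∀ {n m} → HasOrder G n → 0 < m → Clique G m n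
  constant-clique {m = m} order 0<m = (λ i _ → to i) , adjacent
    where
    open Bijection order using (to; injective)
    adjacent : ∀ i j → i ≢ j → Adj G (λ _ → to i) (λ _ → to j)
    adjacent i j i≢j =
      to j ∙ to i ⁻¹ , (i≢j ∘ ≡.sym ∘ injective ∘ x∙y⁻¹≈ε⇒x≈y _ _) , 0 , m , 0<m , ℕ.≤-refl ,
      λ k → inside (z≤n , Fin.toℕ<n k) ≈-refl

  indicator : ∀ {P : Set} → Carrier → Dec P → Carrier
  indicator x (yes _) = x
  indicator x (no _)  = ε

  staircase : ∀ {m} → Carrier → Fin (suc m) → Vertex G m
  staircase x i k = indicator x (toℕ k <? toℕ i)

  ∙ε⁻¹ : ∀ x → x ∙ ε ⁻¹ ≈ x
  ∙ε⁻¹ x = trans (∙-congˡ ε⁻¹≈ε) (identityʳ x)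

  staircase-step : ∀ {x i j k} → i < j → (k<j? : Dec (k < j)) (k<i? : Dec (k < i)) →
                   IntervalValue x i j k (indicator x k<j? ∙ indicator x k<i? ⁻¹)
  staircase-step {x} _   (yes _)   (yes k<i) = outside (λ (i≤k , _) → ℕ.<⇒≱ k<i i≤k) (inverseʳ x)
  staircase-step i<j     (no k≮j)  (yes k<i) = ⊥-elim (k≮j (ℕ.<-trans k<i i<j))
  staircase-step {x} _   (yes k<j) (no k≮i)  = inside (ℕ.≮⇒≥ k≮i , k<j) (∙ε⁻¹ x)
  staircase-step _       (no k≮j)  (no _)    = outside (λ (_ , k<j) → k≮j k<j) (inverseʳ ε)

  staircase-clique : ∀ {m x} → ¬ x ≈ ε → Clique G m (suc m)
  staircase-clique {m} {x} x≉ε = ordered-clique (staircase x) λ {i} {j} i<j →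
    x , x≉ε , toℕ i , toℕ j , i<j , Fin.toℕ≤pred[n] j ,
    λ k → staircase-step i<j (toℕ k <? toℕ j) (toℕ k <? toℕ i)

  square-clique : HasInvolution → Clique G 2 4
  square-clique (a , a≉ε , a≈a⁻¹) = extend-clique (staircase-clique a≉ε) corner corner-adjacent
    where
    corner : Vertex G 2
    corner = ε ∷ a ∷ []
    corner-adjacent : ∀ i → Adj G (staircase a i) corner
    corner-adjacent zero = a , a≉ε , 1 , 2 , ℕ.≤-refl , ℕ.≤-refl , λ where
      zero       → outside (λ { (() , _) }) (inverseʳ ε)
      (suc zero) → inside (s≤s z≤n , ℕ.≤-refl) (∙ε⁻¹ a)
    corner-adjacent (suc zero) = a , a≉ε , 0 , 2 , s≤s z≤n , ℕ.≤-refl , λ where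
      zero       → inside (z≤n , s≤s z≤n) (trans (identityˡ (a ⁻¹)) (sym a≈a⁻¹))
      (suc zero) → inside (z≤n , ℕ.≤-refl) (∙ε⁻¹ a)
    corner-adjacent (suc (suc zero)) = a ⁻¹ , ⁻¹-≉ε a≉ε , 0 , 1 , s≤s z≤n , s≤s z≤n , λ where
      zero       → inside (z≤n , s≤s z≤n) (identityˡ (a ⁻¹))
      (suc zero) → outside (λ { (_ , s≤s ()) }) (inverseʳ a)

  CliqueBound⇒≤ : ∀ {n m t N} → CliqueBound n m t → n ≤ N → suc m ≤ N → (HasInvolution → 4 ≤ N) → t ≤ N
  CliqueBound⇒≤ (inj₁ t≤n)                       n≤N _     _   = ℕ.≤-trans t≤n n≤N
  CliqueBound⇒≤ (inj₂ (inj₁ t≤1+m))              _   1+m≤N _   = ℕ.≤-trans t≤1+m 1+m≤N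
  CliqueBound⇒≤ (inj₂ (inj₂ (t≤4 , involution))) _   _     4≤N = ℕ.≤-trans t≤4 (4≤N involution)

  involution⇒4≤[m+1]⊔n : ∀ {n m} → HasOrder G n → 1 < n → 1 < m → ¬ (m ≡ 2 × n ≡ 2) →
                          HasInvolution → 4 ≤ (m + 1) ⊔ n
  involution⇒4≤[m+1]⊔n {n} {suc (suc (suc m))} _ _ _ _ _ =
    ℕ.≤-trans (s≤s (s≤s (s≤s (ℕ.m≤n+m 1 m)))) (ℕ.m≤m⊔n _ n)
  involution⇒4≤[m+1]⊔n {n} {2} order 1<n _ not-exceptional involution =
    ℕ.≤-trans (Order.involution∧3≤order⇒4≤order order involution 3≤n) (ℕ.m≤n⊔m 3 n)
    where 3≤n = ℕ.≤∧≢⇒< 1<n (not-exceptional ∘ (refl ,_) ∘ ≡.sym)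
  involution⇒4≤[m+1]⊔n {m = 1} _ _ (s≤s ()) _ _

proposition4p7 : ∀ {c ℓ : Level} (G : Group c ℓ) (n m : ℕ) → HasOrder G n → 1 < n → 1 < m →
    ((m ≡ 2 × n ≡ 2) → IsCliqueNumber G m 4)
    × (¬ (m ≡ 2 × n ≡ 2) → IsCliqueNumber G m ((m + 1) ⊔ n))
proposition4p7 G n m order 1<n 1<m = exceptional , generic
  where
  open Order G order using (nontrivial; order<3⇒self-inverse)
  x = proj₁ (nontrivial 1<n)
  x≉ε = proj₂ (nontrivial 1<n)

  exceptional : (m ≡ 2 × n ≡ 2) → IsCliqueNumber G m 4
  exceptional (refl , refl) = square-clique G (x , x≉ε , order<3⇒self-inverse ℕ.≤-refl x) , λ _ K →
    CliqueBound⇒≤ G (clique-bound G order K) (ℕ.m≤n+m 2 2) (ℕ.n≤1+n 3) (λ _ → ℕ.≤-refl)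

  generic : ¬ (m ≡ 2 × n ≡ 2) → IsCliqueNumber G m ((m + 1) ⊔ n)
  generic not-exceptional = lower-bound (ℕ.⊔-sel (m + 1) n) , λ _ K →
    CliqueBound⇒≤ G (clique-bound G order K) (ℕ.m≤n⊔m (m + 1) n)
      (subst (_≤ (m + 1) ⊔ n) (ℕ.+-comm m 1) (ℕ.m≤m⊔n (m + 1) n))
      (involution⇒4≤[m+1]⊔n G order 1<n 1<m not-exceptional)
    where
    lower-bound : (m + 1) ⊔ n ≡ m + 1 ⊎ (m + 1) ⊔ n ≡ n → Clique G m ((m + 1) ⊔ n)
    lower-bound (inj₁ ⊔≡m+1) =
      subst (Clique G m) (≡.trans (ℕ.+-comm 1 m) (≡.sym ⊔≡m+1)) (staircase-clique G x≉ε)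
    lower-bound (inj₂ ⊔≡n)   = subst (Clique G m) (≡.sym ⊔≡n) (constant-clique G order (ℕ.<⇒≤ 1<m))
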